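{- Let $G=(V,E)$ be a finite, simple, connected graph with $n$ vertices, $m$ edges and cyclomatic number $\nu=m-n+1$. Let $T=(V,E')$ be a spanning tree of $G$ that is a solution of the MSTCI problem, i.e. $\cap_G(T)=\cap(G)$. Let $\hat B_T=\{\hat b_e\}_{e\in E'}$ be a non-redundant bond set for $T$, and set $\phi_e=|\hat b_e|-1$ for every $e\in E'$. Then $$\sum_{e\in E'}\binom{\phi_e}{2}\leq \cap(G) \qquad\text{and}\qquad \nu=\sum_{e\in E'}\phi_e.$$
   Context: Edges of $E\setminus E'$ are cycle-edges; a cycle-edge $f=(v,w)$ determines the tree-cycle formed by $f$ and the unique path in $T$ from $v$ to $w$. $\cap_G(T)$ is the number of unordered pairs of distinct tree-cycles (w.r.t. $T$) having at least one edge in common, and $\cap(G)=\min_T\cap_G(T)$ over all spanning trees $T$ of $G$. For a tree-edge $e\in E'$, with $T_1,T_2$ the components of $T-\{e\}$, the bond $b_e$ is the set of edges $(x,y)\in E$ with $x\in T_1$, $y\in T_2$. A non-redundant bond set is a family $\hat B_T=\{\hat b_e\}_{e\in E'}$ with $\hat b_e\subseteq b_e$ for each $e\in E'$ and such that every edge of $E$ belongs to exactly one $\hat b_e$. $\binom{x}{2}=x(x-1)/2$. -}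

module Defs where

open import Data.Nat using (ℕ; zero; suc; _+_; _∸_; _≤_; _<_)
open import Data.Nat.Combinatorics using (_C_)
open import Data.Bool using (Bool; true; false; _∧_; _∨_; not; if_then_else_)
open import Data.Fin using (Fin) renaming (_<_ to _<ᶠ_; _<?_ to _<ᶠ?_)
open import Data.Fin.Properties using (_≟_)
open import Data.List using (List; []; _∷_; length; map; allFin; head; last)
open import Data.Nat.ListAction using (sum)
open import Data.List.Relation.Unary.Unique.Propositional using (Unique)
open import Data.List.Membership.Propositional using (_∈_)
open import Data.Maybe using (just)
open import Data.Product using (Σ; ∃; _×_; _,_)
open import Data.Sum using (_⊎_)
open import Data.Unit using (⊤)
open import Relation.Nullary using (¬_)
open import Relation.Nullary.Decidable using (⌊_⌋)
open import Relation.Binary.PropositionalEquality using (_≡_)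
open import Function.Bundles using (_⇔_)

-- Finite, simple graphs on the vertex set Fin n (Bool adjacency).
-- An (undirected) edge {u,v} is represented by the ordered pair (u,v) with u < v.

record SimpleGraph (n : ℕ) : Set where
  field
    adj    : Fin n → Fin n → Bool
    sym    : ∀ u v → adj u v ≡ adj v u
    irrefl : ∀ u → adj u u ≡ false
open SimpleGraph public

Rel : ℕ → Set
Rel n = Fin n → Fin n → Bool

module _ {n : ℕ} where

  sumPairs : (Fin n → Fin n → ℕ) → ℕ
  sumPairs g = sum (map (λ u → sum (map (λ v → if ⌊ u <ᶠ? v ⌋ then g u v else 0) (allFin n))) (allFin n))

  countPairs : Rel n → ℕ
  countPairs R = sumPairs (λ u v → if R u v then 1 else 0)

  Chain : Rel n → List (Fin n) → Set
  Chain R []           = ⊤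
  Chain R (x ∷ [])     = ⊤
  Chain R (x ∷ y ∷ xs) = (R x y ≡ true) × Chain R (y ∷ xs)

  record Path (R : Rel n) (u v : Fin n) : Set where
    field
      verts  : List (Fin n)
      first  : head verts ≡ just u
      final  : last verts ≡ just v
      chain  : Chain R verts
      simple : Unique verts
  open Path public

  HasStep : List (Fin n) → Fin n → Fin n → Set
  HasStep []           a b = Data.Empty.⊥
    where import Data.Empty
  HasStep (x ∷ [])     a b = Data.Empty.⊥
    where import Data.Empty
  HasStep (x ∷ y ∷ xs) a b = ((x ≡ a × y ≡ b) ⊎ (x ≡ b × y ≡ a)) ⊎ HasStep (y ∷ xs) a b

  HasCycle : Rel n → Set
  HasCycle R = Σ (List (Fin n)) λ xs → Σ (Fin n) λ x0 → Σ (Fin n) λ xk →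
    (3 ≤ length xs) × (head xs ≡ just x0) × (last xs ≡ just xk) ×
    Chain R xs × Unique xs × (R xk x0 ≡ true)

  Connected : Rel n → Set
  Connected R = (0 < n) × (∀ u v → Path R u v)

  Acyclic : Rel n → Set
  Acyclic R = ¬ HasCycle R

  IsTree : Rel n → Set
  IsTree R = Connected R × Acyclic R

  record SpanningTree (G : SimpleGraph n) (t : Rel n) : Set where
    field
      sub  : ∀ u v → t u v ≡ true → adj G u v ≡ true
      tsym : ∀ u v → t u v ≡ t v u
      tree : IsTree t

  GEdge : SimpleGraph n → Fin n → Fin n → Set
  GEdge G u v = (u <ᶠ v) × (adj G u v ≡ true)

  TreeEdge : Rel n → Fin n → Fin n → Set
  TreeEdge t u v = (u <ᶠ v) × (t u v ≡ true)

  CycleEdge : SimpleGraph n → Rel n → Fin n → Fin n → Set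
  CycleEdge G t u v = GEdge G u v × (t u v ≡ false)

  -- the edge {a,b} belongs to the tree-cycle of the cycle-edge (v,w):
  -- it is f itself or an edge of the (unique) path in T from v to w
  InTreeCycle : Rel n → Fin n → Fin n → Fin n → Fin n → Set
  InTreeCycle t v w a b =
    ((v ≡ a × w ≡ b) ⊎ (v ≡ b × w ≡ a)) ⊎ Σ (Path t v w) λ p → HasStep (verts p) a b

  -- lexicographic strict order on pairs (to count unordered pairs of edges once)
  _<ₑ_ : Fin n × Fin n → Fin n × Fin n → Set
  (u , v) <ₑ (u' , v') = (u <ᶠ u') ⊎ ((u ≡ u') × (v <ᶠ v'))

  IntersectingPair : SimpleGraph n → Rel n → (Fin n × Fin n) × (Fin n × Fin n) → Set
  IntersectingPair G t ((v , w) , (v' , w')) =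
    CycleEdge G t v w × CycleEdge G t v' w' × ((v , w) <ₑ (v' , w')) ×
    (∃ λ a → ∃ λ b → InTreeCycle t v w a b × InTreeCycle t v' w' a b)

HasCard : {A : Set} → (A → Set) → ℕ → Set
HasCard {A} P k = Σ (List A) λ xs → Unique xs × (∀ x → (x ∈ xs) ⇔ P x) × (length xs ≡ k)

-- bhat a b : the subset \hat b_e (on pairs x < y) for the tree edge e = {a,b}
BondFamily : ℕ → Set
BondFamily n = Fin n → Fin n → Fin n → Fin n → Bool

module _ {n : ℕ} where

  CapT : SimpleGraph n → Rel n → ℕ → Set
  CapT G t k = HasCard (IntersectingPair G t) k

  IsMSTCI : SimpleGraph n → Rel n → ℕ → Set
  IsMSTCI G t k = SpanningTree G t × CapT G t k ×
    (∀ t' k' → SpanningTree G t' → CapT G t' k' → k ≤ k')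

  removeEdge : Rel n → Fin n → Fin n → Rel n
  removeEdge t a b x y =
    t x y ∧ not ((⌊ x ≟ a ⌋ ∧ ⌊ y ≟ b ⌋) ∨ (⌊ x ≟ b ⌋ ∧ ⌊ y ≟ a ⌋))

  InBond : SimpleGraph n → Rel n → Fin n → Fin n → Fin n → Fin n → Set
  InBond G t a b x y = GEdge G x y ×
    ((Path (removeEdge t a b) a x × Path (removeEdge t a b) b y) ⊎
     (Path (removeEdge t a b) b x × Path (removeEdge t a b) a y))

  record NonRedundantBondSet (G : SimpleGraph n) (t : Rel n) (bhat : BondFamily n) : Set where
    field
      subset : ∀ a b x y → TreeEdge t a b → x <ᶠ y → bhat a b x y ≡ true → InBond G t a b x y
      cover  : ∀ x y → GEdge G x y → ∃ λ a → ∃ λ b → TreeEdge t a b × (bhat a b x y ≡ true)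
      unique : ∀ x y a b a' b' → GEdge G x y → TreeEdge t a b → TreeEdge t a' b' →
               bhat a b x y ≡ true → bhat a' b' x y ≡ true → (a ≡ a') × (b ≡ b')

  bondSize : BondFamily n → Fin n → Fin n → ℕ
  bondSize bhat a b = countPairs (bhat a b)

  phi : BondFamily n → Fin n → Fin n → ℕ
  phi bhat a b = bondSize bhat a b ∸ 1

  sumTree : Rel n → (Fin n → Fin n → ℕ) → ℕ
  sumTree t g = sumPairs (λ a b → if t a b then g a b else 0)

  cyclomatic : SimpleGraph n → ℕ
  cyclomatic G = countPairs (adj G) + 1 ∸ n

-- Every edge of G lies in exactly one \hat b_e. A tree edge e lies in no bond b_e′ with e′ ≠ e,
-- since e itself joins its ends in T − e′; so \hat b_e consists of e and φ_e cycle-edges.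
-- Summing |\hat b_e| over the n − 1 tree edges (counted through the parent map of a rooted
-- tree) gives m = Σ φ_e + n − 1, i.e. ν = Σ φ_e. The tree-cycle of a cycle-edge in b_e passes
-- through e, because T − e separates its ends; so any two cycle-edges of \hat b_e form an
-- intersecting pair, and as the \hat b_e are disjoint, distinct e yield distinct pairs:
-- Σ C(φ_e, 2) ≤ ∩_G(T) = ∩(G).

module Submission where

open import Defs
open import Data.Bool using (Bool; true; false; _∧_; _∨_; not; if_then_else_)
open import Data.Bool.Properties using (∧-zeroʳ)
open import Data.Empty using (⊥; ⊥-elim)
open import Data.Fin as Fin using (Fin) renaming (_<_ to _<ᶠ_; _<?_ to _<ᶠ?_)
open import Data.Fin.Properties as Finₚ using (_≟_)
open import Data.List using (List; []; _∷_; _++_; length; map; allFin; last; filter)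
open import Data.List.Membership.Propositional using (_∈_; _∉_)
open import Data.List.Membership.Propositional.Properties
  using (∈-∃++; ∈-map⁺; ∈-map⁻; ∈-++⁺ˡ; ∈-++⁺ʳ; ∈-++⁻; ∈-filter⁺; ∈-filter⁻; ∈-allFin)
open import Data.List.Properties using (length-tabulate; ++-assoc)
open import Data.List.Relation.Unary.All as All using (All; []; _∷_)
open import Data.List.Relation.Unary.All.Properties using (¬Any⇒All¬; All¬⇒¬Any) renaming (++⁻ˡ to All-++⁻ˡ)
open import Data.List.Relation.Unary.Any using (here; there)
open import Data.List.Relation.Unary.AllPairs as AllPairs using (AllPairs; []; _∷_)
import Data.List.Relation.Unary.AllPairs.Properties as AllPairsₚ
open import Data.List.Relation.Unary.Unique.Propositional using (Unique)
import Data.List.Relation.Unary.Unique.Propositional.Properties as Uniqueₚ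
open import Data.Maybe using (just)
open import Data.Maybe.Properties using (just-injective)
open import Function using (_∘_; id; flip)
open import Data.Nat using (ℕ; zero; suc; _+_; _*_; _∸_; _≤_; _<_; z≤n; s≤s)
open import Data.Nat.Combinatorics using (_C_; nCk+nC[k+1]≡[n+1]C[k+1]; nC1≡n)
open import Data.Nat.ListAction using (sum)
open import Data.Nat.Properties
  using ( +-assoc; +-identityʳ; *-identityˡ; *-zeroʳ; *-distribˡ-+; +-commutativeSemigroup
        ; ≤-refl; ≤-reflexive; ≤-trans; m≤m+n; m≤n+m; +-mono-≤; ∸-monoˡ-≤; m≤n⇒m<n∨m≡n
        ; m+n∸n≡m; m∸n+n≡m; module ≤-Reasoning )
open import Data.Product as Product using (Σ; ∃; _×_; _,_; proj₁; proj₂; uncurry)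
open import Data.Product.Properties using (≡-dec)
open import Data.Sum using (_⊎_; inj₁; inj₂; [_,_]′)
open import Data.Unit using (tt)
open import Function.Bundles using (Equivalence)
open import Relation.Binary.Definitions using (DecidableEquality; tri<; tri≈; tri>)
open import Relation.Binary.PropositionalEquality renaming (sym to ≡-sym)
open import Relation.Nullary using (¬_; Dec; yes; no; does)
open import Relation.Nullary.Decidable using (⌊_⌋; isYes≗does; dec-true; dec-false; _×-dec_; _⊎-dec_)
open import Level using (0ℓ)
open import Algebra.Properties.CommutativeSemigroup +-commutativeSemigroup using (interchange)
open import Relation.Unary using (Pred; Decidable)

-- Lists and finite sums

module _ {A : Set} where

  unique-++⁻ˡ : ∀ (xs : List A) {ys} → Unique (xs ++ ys) → Unique xs
  unique-++⁻ˡ []       _              = []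
  unique-++⁻ˡ (x ∷ xs) (x∉ ∷ unique) = All-++⁻ˡ xs x∉ ∷ unique-++⁻ˡ xs unique

  unique-++⁻ʳ : ∀ (xs : List A) {ys} → Unique (xs ++ ys) → Unique ys
  unique-++⁻ʳ []       unique       = unique
  unique-++⁻ʳ (x ∷ xs) (_ ∷ unique) = unique-++⁻ʳ xs unique

  lastOf : A → List A → A
  lastOf x []       = x
  lastOf _ (y ∷ ys) = lastOf y ys

  lastOf-∈ : ∀ x xs → lastOf x xs ∈ x ∷ xs
  lastOf-∈ x []       = here refl
  lastOf-∈ _ (y ∷ ys) = there (lastOf-∈ y ys)

  lastOf-++ : ∀ x xs {y ys} → lastOf x (xs ++ y ∷ ys) ≡ lastOf y ys
  lastOf-++ x []       = refl
  lastOf-++ _ (z ∷ zs) = lastOf-++ z zs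

  last≡lastOf : ∀ x xs → last (x ∷ xs) ≡ just (lastOf x xs)
  last≡lastOf x []       = refl
  last≡lastOf _ (y ∷ ys) = last≡lastOf y ys

∑ : {A : Set} → List A → (A → ℕ) → ℕ
∑ xs f = sum (map f xs)

𝟙 : Bool → ℕ
𝟙 b = if b then 1 else 0

𝟙≤1 : ∀ b → 𝟙 b ≤ 1
𝟙≤1 true  = s≤s z≤n
𝟙≤1 false = z≤n

module _ {A : Set} where

  ∑-++ : ∀ (xs ys : List A) f → ∑ (xs ++ ys) f ≡ ∑ xs f + ∑ ys f
  ∑-++ []       ys f = refl
  ∑-++ (x ∷ xs) ys f = trans (cong (f x +_) (∑-++ xs ys f)) (≡-sym (+-assoc (f x) _ _))

  ∑-+ : ∀ (xs : List A) f g → ∑ xs (λ x → f x + g x) ≡ ∑ xs f + ∑ xs g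
  ∑-+ []       f g = refl
  ∑-+ (x ∷ xs) f g = trans (cong (f x + g x +_) (∑-+ xs f g)) (interchange (f x) (g x) _ _)

  ∑-*ˡ : ∀ (xs : List A) k f → ∑ xs (λ x → k * f x) ≡ k * ∑ xs f
  ∑-*ˡ []       k f = ≡-sym (*-zeroʳ k)
  ∑-*ˡ (x ∷ xs) k f = trans (cong (k * f x +_) (∑-*ˡ xs k f)) (≡-sym (*-distribˡ-+ k (f x) _))

  ∑-cong : ∀ (xs : List A) {f g} → (∀ x → x ∈ xs → f x ≡ g x) → ∑ xs f ≡ ∑ xs g
  ∑-cong []       _  = refl
  ∑-cong (x ∷ xs) eq = cong₂ _+_ (eq x (here refl)) (∑-cong xs (λ y → eq y ∘ there))

  ∑-mono : ∀ (xs : List A) {f g} → (∀ x → x ∈ xs → f x ≤ g x) → ∑ xs f ≤ ∑ xs g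
  ∑-mono []       _  = z≤n
  ∑-mono (x ∷ xs) le = +-mono-≤ (le x (here refl)) (∑-mono xs (λ y → le y ∘ there))

  ∑-zero : ∀ (xs : List A) {f} → (∀ x → x ∈ xs → f x ≡ 0) → ∑ xs f ≡ 0
  ∑-zero []       _  = refl
  ∑-zero (x ∷ xs) eq rewrite eq x (here refl) = ∑-zero xs (λ y → eq y ∘ there)

  ∑-const-1 : ∀ (xs : List A) → ∑ xs (λ _ → 1) ≡ length xs
  ∑-const-1 []       = refl
  ∑-const-1 (_ ∷ xs) = cong suc (∑-const-1 xs)

  ∑-if : ∀ (xs : List A) b f → (if b then ∑ xs f else 0) ≡ ∑ xs (λ x → if b then f x else 0)
  ∑-if xs true  f = refl
  ∑-if xs false f = ≡-sym (∑-zero xs (λ _ _ → refl))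

  term≤∑ : ∀ (xs : List A) {f c} → c ∈ xs → f c ≤ ∑ xs f
  term≤∑ (x ∷ xs)     (here refl) = m≤m+n _ _
  term≤∑ (x ∷ xs) {f} (there c∈)  = ≤-trans (term≤∑ xs c∈) (m≤n+m _ (f x))

  ∑-single : ∀ (xs : List A) {f c} → Unique xs → c ∈ xs → (∀ x → x ∈ xs → x ≢ c → f x ≡ 0) → ∑ xs f ≡ f c
  ∑-single (x ∷ xs) {f} (x∉ ∷ _) (here refl) others =
    trans (cong (f x +_) (∑-zero xs (λ y y∈ → others y (there y∈) (λ { refl → All¬⇒¬Any x∉ y∈ }))))
          (+-identityʳ (f x))
  ∑-single (x ∷ xs) (x∉ ∷ u) (there c∈) others
    rewrite others x (here refl) (λ { refl → All¬⇒¬Any x∉ c∈ }) = ∑-single xs u c∈ (λ y → others y ∘ there)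

  ∑-pos : ∀ (xs : List A) f → 0 < ∑ xs f → ∃ λ x → x ∈ xs × 0 < f x
  ∑-pos (x ∷ xs) f pos with f x in fx
  ... | suc _ = x , here refl , subst (0 <_) (≡-sym fx) (s≤s z≤n)
  ... | zero with ∑-pos xs f pos
  ...   | y , y∈ , fy = y , there y∈ , fy

  ∑-𝟙-≡ : ∀ (_≟ₐ_ : DecidableEquality A) (xs : List A) {c} → Unique xs → c ∈ xs →
          ∑ xs (λ x → 𝟙 ⌊ x ≟ₐ c ⌋) ≡ 1
  ∑-𝟙-≡ _≟ₐ_ xs {c} u c∈ = trans (∑-single xs u c∈ off) at-c
    where
      off : ∀ x → x ∈ xs → x ≢ c → 𝟙 ⌊ x ≟ₐ c ⌋ ≡ 0
      off x _ x≢c with x ≟ₐ c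
      ... | yes x≡c = ⊥-elim (x≢c x≡c)
      ... | no  _   = refl
      at-c : 𝟙 ⌊ c ≟ₐ c ⌋ ≡ 1
      at-c with c ≟ₐ c
      ... | yes _   = refl
      ... | no  c≢c = ⊥-elim (c≢c refl)

  private
    remove : ∀ {x} (ys : List A) → x ∈ ys → List A
    remove (_ ∷ ys) (here _)  = ys
    remove (y ∷ ys) (there x∈) = y ∷ remove ys x∈

    length-remove : ∀ {x} (ys : List A) (x∈ : x ∈ ys) → suc (length (remove ys x∈)) ≡ length ys
    length-remove (_ ∷ ys) (here _)  = refl
    length-remove (_ ∷ ys) (there x∈) = cong suc (length-remove ys x∈)

    ∈-remove : ∀ {x y} (ys : List A) (x∈ : x ∈ ys) → y ∈ ys → y ≢ x → y ∈ remove ys x∈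
    ∈-remove (_ ∷ ys) (here refl) (here refl) y≢x = ⊥-elim (y≢x refl)
    ∈-remove (_ ∷ ys) (here _)    (there y∈)  _   = y∈
    ∈-remove (_ ∷ ys) (there _)   (here refl) _   = here refl
    ∈-remove (_ ∷ ys) (there x∈)  (there y∈)  y≢x = there (∈-remove ys x∈ y∈ y≢x)

  ∑-≤-length : ∀ (xs : List A) f ys → Unique xs → (∀ x → x ∈ xs → f x ≤ 1) →
               (∀ x → x ∈ xs → 0 < f x → x ∈ ys) → ∑ xs f ≤ length ys
  ∑-≤-length []       f ys _        _   _       = z≤n
  ∑-≤-length (x ∷ xs) f ys (x∉ ∷ u) f≤1 support with f x in fx
  ... | zero  = ∑-≤-length xs f ys u (λ y → f≤1 y ∘ there) (λ y → support y ∘ there)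
  ... | suc _ = ≤-trans (+-mono-≤ (subst (_≤ 1) fx (f≤1 x (here refl))) rest) (≤-reflexive (length-remove ys x∈ys))
    where
      x∈ys : x ∈ ys
      x∈ys = support x (here refl) (subst (0 <_) (≡-sym fx) (s≤s z≤n))
      rest : ∑ xs f ≤ length (remove ys x∈ys)
      rest = ∑-≤-length xs f (remove ys x∈ys) u (λ y → f≤1 y ∘ there)
        (λ y y∈ fy → ∈-remove ys x∈ys (support y (there y∈) fy) (λ { refl → All¬⇒¬Any x∉ y∈ }))

  ∑-≤1 : ∀ (xs : List A) f → Unique xs → (∀ x → x ∈ xs → f x ≤ 1) →
         (∀ x y → x ∈ xs → y ∈ xs → 0 < f x → 0 < f y → x ≡ y) → ∑ xs f ≤ 1
  ∑-≤1 xs f u f≤1 same with ∑ xs f in total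
  ... | zero  = z≤n
  ... | suc s with ∑-pos xs f (subst (0 <_) (≡-sym total) (s≤s z≤n))
  ...   | x , x∈ , fx = subst (_≤ 1) total
          (∑-≤-length xs f (x ∷ []) u f≤1 (λ y y∈ fy → here (same y x y∈ x∈ fy fx)))

∑-swap : ∀ {A B : Set} (xs : List A) (ys : List B) (f : A → B → ℕ) →
         ∑ xs (λ x → ∑ ys (f x)) ≡ ∑ ys (λ y → ∑ xs (λ x → f x y))
∑-swap []       ys f = ≡-sym (∑-zero ys (λ _ _ → refl))
∑-swap (x ∷ xs) ys f = trans (cong (∑ ys (f x) +_) (∑-swap xs ys f)) (≡-sym (∑-+ ys (f x) _))

∑-map : ∀ {A B : Set} (g : A → B) (xs : List A) (f : B → ℕ) → ∑ (map g xs) f ≡ ∑ xs (f ∘ g)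
∑-map g []       f = refl
∑-map g (x ∷ xs) f = cong (f (g x) +_) (∑-map g xs f)

∑-filter : ∀ {A : Set} {P : Pred A 0ℓ} (P? : Decidable P) (xs : List A) (f : A → ℕ) →
           ∑ (filter P? xs) f ≡ ∑ xs (λ x → if ⌊ P? x ⌋ then f x else 0)
∑-filter P? []       f = refl
∑-filter P? (x ∷ xs) f with P? x
... | yes _ = cong (f x +_) (∑-filter P? xs f)
... | no  _ = ∑-filter P? xs f

pairs : ∀ {A : Set} → List A → List (A × A)
pairs []       = []
pairs (x ∷ xs) = map (x ,_) xs ++ pairs xs

module _ {A : Set} where

  ∈-pairs⁻ : ∀ (xs : List A) {p} → p ∈ pairs xs → proj₁ p ∈ xs × proj₂ p ∈ xs
  ∈-pairs⁻ (x ∷ xs) p∈ with ∈-++⁻ (map (x ,_) xs) p∈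
  ... | inj₂ p∈′ = Product.map there there (∈-pairs⁻ xs p∈′)
  ... | inj₁ p∈′ with ∈-map⁻ (x ,_) p∈′
  ...   | y , y∈ , refl = here refl , there y∈

  pairs-related : ∀ {R : A → A → Set} (xs : List A) {p} → AllPairs R xs → p ∈ pairs xs → R (proj₁ p) (proj₂ p)
  pairs-related (x ∷ xs) (x~ ∷ related) p∈ with ∈-++⁻ (map (x ,_) xs) p∈
  ... | inj₂ p∈′ = pairs-related xs related p∈′
  ... | inj₁ p∈′ with ∈-map⁻ (x ,_) p∈′
  ...   | y , y∈ , refl = All.lookup x~ y∈

  pairs-unique : ∀ {xs : List A} → Unique xs → Unique (pairs xs)
  pairs-unique {[]}     _        = []
  pairs-unique {x ∷ xs} (x∉ ∷ u) = Uniqueₚ.++⁺ (Uniqueₚ.map⁺ (cong proj₂) u) (pairs-unique u) disjoint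
    where
      disjoint : ∀ {p} → ¬ (p ∈ map (x ,_) xs × p ∈ pairs xs)
      disjoint (p∈ , p∈′) with ∈-map⁻ (x ,_) p∈
      ... | _ , _ , refl = All¬⇒¬Any x∉ (proj₁ (∈-pairs⁻ xs p∈′))

C2-suc : ∀ c → suc c C 2 ≡ c + c C 2
C2-suc c = trans (≡-sym (nCk+nC[k+1]≡[n+1]C[k+1] c 1)) (cong (_+ c C 2) (nC1≡n c))

C2-mono : ∀ {x y} → x ≤ y → x C 2 ≤ y C 2
C2-mono {y = zero}  z≤n = ≤-refl
C2-mono {y = suc y} x≤y with m≤n⇒m<n∨m≡n x≤y
... | inj₂ refl      = ≤-refl
... | inj₁ (s≤s x≤y′) = ≤-trans (C2-mono x≤y′) (subst (y C 2 ≤_) (≡-sym (C2-suc y)) (m≤n+m _ y))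

∑-pairs : ∀ {A : Set} (xs : List A) (g : A → ℕ) → (∀ x → g x ≤ 1) →
          ∑ (pairs xs) (λ p → g (proj₁ p) * g (proj₂ p)) ≡ ∑ xs g C 2
∑-pairs []       g g≤1 = refl
∑-pairs (x ∷ xs) g g≤1 = begin
  ∑ (map (x ,_) xs ++ pairs xs) h         ≡⟨ ∑-++ (map (x ,_) xs) (pairs xs) h ⟩
  ∑ (map (x ,_) xs) h + ∑ (pairs xs) h    ≡⟨ cong₂ _+_ (trans (∑-map (x ,_) xs h) (∑-*ˡ xs (g x) g)) (∑-pairs xs g g≤1) ⟩
  g x * ∑ xs g + ∑ xs g C 2               ≡⟨ step (g x) (g≤1 x) ⟩
  (g x + ∑ xs g) C 2                      ∎
  where
    open ≡-Reasoning
    h : _ → ℕ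
    h p = g (proj₁ p) * g (proj₂ p)
    step : ∀ k → k ≤ 1 → k * ∑ xs g + ∑ xs g C 2 ≡ (k + ∑ xs g) C 2
    step zero          _ = refl
    step (suc zero)    _ = trans (cong (_+ ∑ xs g C 2) (*-identityˡ (∑ xs g))) (≡-sym (C2-suc (∑ xs g)))
    step (suc (suc _)) (s≤s ())

-- Pairs of vertices

module _ {n : ℕ} where

  private
    edgesFrom : Fin n → List (Fin n × Fin n)
    edgesFrom u = map (u ,_) (filter (u <ᶠ?_) (allFin n))

    edgesFromAll : List (Fin n) → List (Fin n × Fin n)
    edgesFromAll []       = []
    edgesFromAll (u ∷ us) = edgesFrom u ++ edgesFromAll us

    ∈-edgesFrom⁻ : ∀ {u p} → p ∈ edgesFrom u → proj₁ p ≡ u × proj₁ p <ᶠ proj₂ p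
    ∈-edgesFrom⁻ {u} p∈ with ∈-map⁻ (u ,_) p∈
    ... | v , v∈ , refl = refl , proj₂ (∈-filter⁻ (u <ᶠ?_) {xs = allFin n} v∈)

    ∈-edgesFromAll⁻ : ∀ us {p} → p ∈ edgesFromAll us → proj₁ p ∈ us × proj₁ p <ᶠ proj₂ p
    ∈-edgesFromAll⁻ (u ∷ us) p∈ with ∈-++⁻ (edgesFrom u) p∈
    ... | inj₁ p∈′ = here (proj₁ (∈-edgesFrom⁻ p∈′)) , proj₂ (∈-edgesFrom⁻ p∈′)
    ... | inj₂ p∈′ = Product.map₁ there (∈-edgesFromAll⁻ us p∈′)

    ∈-edgesFromAll⁺ : ∀ us {u v} → u ∈ us → u <ᶠ v → (u , v) ∈ edgesFromAll us
    ∈-edgesFromAll⁺ (_ ∷ _) {u} {v} (here refl) u<v =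
      ∈-++⁺ˡ (∈-map⁺ (u ,_) (∈-filter⁺ (u <ᶠ?_) (∈-allFin v) u<v))
    ∈-edgesFromAll⁺ (u′ ∷ us) (there u∈) u<v = ∈-++⁺ʳ (edgesFrom u′) (∈-edgesFromAll⁺ us u∈ u<v)

    edgesFromAll-sorted : ∀ us → AllPairs _<ᶠ_ us → AllPairs _<ₑ_ (edgesFromAll us)
    edgesFromAll-sorted []       _          = []
    edgesFromAll-sorted (u ∷ us) (u< ∷ us<) =
      AllPairsₚ.++⁺ within (edgesFromAll-sorted us us<) across
      where
        within : AllPairs _<ₑ_ (edgesFrom u)
        within = AllPairsₚ.map⁺ (AllPairs.map (λ v<w → inj₂ (refl , v<w))
                   (AllPairsₚ.filter⁺ (u <ᶠ?_) (AllPairsₚ.tabulate⁺-< id)))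
        across : All (λ p → All (p <ₑ_) (edgesFromAll us)) (edgesFrom u)
        across = All.tabulate λ p∈ → All.tabulate λ q∈ →
          inj₁ (subst (_<ᶠ _) (≡-sym (proj₁ (∈-edgesFrom⁻ p∈))) (All.lookup u< (proj₁ (∈-edgesFromAll⁻ us q∈))))

    sumPairs-edgesFromAll : ∀ us (g : Fin n → Fin n → ℕ) →
      ∑ us (λ u → ∑ (allFin n) (λ v → if ⌊ u <ᶠ? v ⌋ then g u v else 0)) ≡ ∑ (edgesFromAll us) (uncurry g)
    sumPairs-edgesFromAll []       g = refl
    sumPairs-edgesFromAll (u ∷ us) g = begin
      ∑ (allFin n) (λ v → if ⌊ u <ᶠ? v ⌋ then g u v else 0) + _
        ≡⟨ cong₂ _+_ (≡-sym (trans (∑-map (u ,_) (filter (u <ᶠ?_) (allFin n)) (uncurry g)) (∑-filter (u <ᶠ?_) (allFin n) (g u))))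
                     (sumPairs-edgesFromAll us g) ⟩
      ∑ (edgesFrom u) (uncurry g) + ∑ (edgesFromAll us) (uncurry g)
        ≡⟨ ≡-sym (∑-++ (edgesFrom u) (edgesFromAll us) (uncurry g)) ⟩
      ∑ (edgesFromAll (u ∷ us)) (uncurry g) ∎
      where open ≡-Reasoning

  allEdges : List (Fin n × Fin n)
  allEdges = edgesFromAll (allFin n)

  sumPairs≡∑allEdges : ∀ g → sumPairs g ≡ ∑ allEdges (uncurry g)
  sumPairs≡∑allEdges = sumPairs-edgesFromAll (allFin n)

  ∈-allEdges⁻ : ∀ {p} → p ∈ allEdges → proj₁ p <ᶠ proj₂ p
  ∈-allEdges⁻ p∈ = proj₂ (∈-edgesFromAll⁻ (allFin n) p∈)

  ∈-allEdges⁺ : ∀ {u v} → u <ᶠ v → (u , v) ∈ allEdges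
  ∈-allEdges⁺ {u} = ∈-edgesFromAll⁺ (allFin n) (∈-allFin u)

  allEdges-sorted : AllPairs _<ₑ_ allEdges
  allEdges-sorted = edgesFromAll-sorted (allFin n) (AllPairsₚ.tabulate⁺-< id)

  allEdges-unique : Unique allEdges
  allEdges-unique = AllPairs.map <ₑ⇒≢ allEdges-sorted
    where
      <ₑ⇒≢ : ∀ {p q} → p <ₑ q → p ≢ q
      <ₑ⇒≢ (inj₁ u<u′)       refl = Finₚ.<-irrefl refl u<u′
      <ₑ⇒≢ (inj₂ (_ , v<v′)) refl = Finₚ.<-irrefl refl v<v′

  sumPairs-cong : ∀ {f g : Fin n → Fin n → ℕ} → (∀ u v → u <ᶠ v → f u v ≡ g u v) → sumPairs f ≡ sumPairs g
  sumPairs-cong {f} {g} eq = begin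
    sumPairs f                  ≡⟨ sumPairs≡∑allEdges f ⟩
    ∑ allEdges (uncurry f)      ≡⟨ ∑-cong allEdges (λ p p∈ → eq _ _ (∈-allEdges⁻ p∈)) ⟩
    ∑ allEdges (uncurry g)      ≡⟨ ≡-sym (sumPairs≡∑allEdges g) ⟩
    sumPairs g                  ∎
    where open ≡-Reasoning

  sumPairs-symmetrise : ∀ (g : Fin n → Fin n → ℕ) →
    sumPairs (λ u v → g u v + g v u) ≡ ∑ (allFin n) (λ u → ∑ (allFin n) (λ v → if ⌊ u ≟ v ⌋ then 0 else g u v))
  sumPairs-symmetrise g = begin
    sumPairs (λ u v → g u v + g v u)
      ≡⟨ ∑∑-cong (λ u v → if-+ ⌊ u <ᶠ? v ⌋ (g u v) (g v u)) ⟩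
    ∑∑ (λ u v → below u v g + below u v (flip g))
      ≡⟨ ∑∑-+ (λ u v → below u v g) (λ u v → below u v (flip g)) ⟩
    ∑∑ (λ u v → below u v g) + ∑∑ (λ u v → below u v (flip g))
      ≡⟨ cong (∑∑ (λ u v → below u v g) +_) (∑-swap Fs Fs (λ u v → below u v (flip g))) ⟩
    ∑∑ (λ u v → below u v g) + ∑∑ (λ u v → below v u (flip g))
      ≡⟨ ≡-sym (∑∑-+ (λ u v → below u v g) (λ u v → below v u (flip g))) ⟩
    ∑∑ (λ u v → below u v g + below v u (flip g))
      ≡⟨ ∑∑-cong (λ u v → trichotomy u v (g u v)) ⟩
    ∑∑ (λ u v → if ⌊ u ≟ v ⌋ then 0 else g u v) ∎
    where
      open ≡-Reasoning
      Fs = allFin n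
      ∑∑ : (Fin n → Fin n → ℕ) → ℕ
      ∑∑ f = ∑ Fs (λ u → ∑ Fs (f u))
      ∑∑-cong : ∀ {f h} → (∀ u v → f u v ≡ h u v) → ∑∑ f ≡ ∑∑ h
      ∑∑-cong eq = ∑-cong Fs (λ u _ → ∑-cong Fs (λ v _ → eq u v))
      ∑∑-+ : ∀ f h → ∑∑ (λ u v → f u v + h u v) ≡ ∑∑ f + ∑∑ h
      ∑∑-+ f h = trans (∑-cong Fs (λ u _ → ∑-+ Fs (f u) (h u))) (∑-+ Fs _ _)
      below : Fin n → Fin n → (Fin n → Fin n → ℕ) → ℕ
      below u v f = if ⌊ u <ᶠ? v ⌋ then f u v else 0
      if-+ : ∀ c x y → (if c then x + y else 0) ≡ (if c then x else 0) + (if c then y else 0)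
      if-+ true  _ _ = refl
      if-+ false _ _ = refl
      trichotomy : ∀ u v x → (if ⌊ u <ᶠ? v ⌋ then x else 0) + (if ⌊ v <ᶠ? u ⌋ then x else 0) ≡
                             (if ⌊ u ≟ v ⌋ then 0 else x)
      trichotomy u v x with Finₚ.<-cmp u v | u <ᶠ? v | v <ᶠ? u | u ≟ v
      ... | _             | yes u<v | yes v<u | _       = ⊥-elim (Finₚ.<-asym u<v v<u)
      ... | tri≈ _ u≡v _  | _       | _       | no u≢v  = ⊥-elim (u≢v u≡v)
      ... | tri< u<v _ _  | no u≮v  | _       | _       = ⊥-elim (u≮v u<v)
      ... | tri> _ _ v<u  | _       | no v≮u  | _       = ⊥-elim (v≮u v<u)
      ... | tri< u<v _ _  | yes _   | no _    | yes refl = ⊥-elim (Finₚ.<-irrefl refl u<v)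
      ... | tri< _ _ _    | yes _   | no _    | no _    = +-identityʳ x
      ... | tri> _ _ v<u  | no _    | yes _   | yes refl = ⊥-elim (Finₚ.<-irrefl refl v<u)
      ... | tri> _ _ _    | no _    | yes _   | no _    = refl
      ... | tri≈ _ _ _    | no _    | no _    | yes _   = refl
      ... | tri≈ _ refl _ | yes u<u | no _    | _       = ⊥-elim (Finₚ.<-irrefl refl u<u)
      ... | tri≈ _ refl _ | no _    | yes u<u | _       = ⊥-elim (Finₚ.<-irrefl refl u<u)

  ∑-allFin-except : ∀ (r : Fin n) → ∑ (allFin n) (λ u → if ⌊ u ≟ r ⌋ then 0 else 1) + 1 ≡ n
  ∑-allFin-except r = begin
    ∑ Fs others + 1                    ≡⟨ cong (∑ Fs others +_) (≡-sym (∑-𝟙-≡ _≟_ Fs (Uniqueₚ.allFin⁺ n) (∈-allFin r))) ⟩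
    ∑ Fs others + ∑ Fs (𝟙 ∘ is-r)      ≡⟨ ≡-sym (∑-+ Fs others (𝟙 ∘ is-r)) ⟩
    ∑ Fs (λ u → others u + 𝟙 (is-r u)) ≡⟨ ∑-cong Fs (λ u _ → split (is-r u)) ⟩
    ∑ Fs (λ _ → 1)                     ≡⟨ ∑-const-1 Fs ⟩
    length Fs                          ≡⟨ length-tabulate id ⟩
    n                                  ∎
    where
      open ≡-Reasoning
      Fs = allFin n
      is-r : Fin n → Bool
      is-r u = ⌊ u ≟ r ⌋
      others : Fin n → ℕ
      others u = if is-r u then 0 else 1
      split : ∀ b → (if b then 0 else 1) + 𝟙 b ≡ 1
      split true  = refl
      split false = refl

-- Paths in a symmetric relation

module Paths {n : ℕ} (R : Rel n) (R-sym : ∀ x y → R x y ≡ true → R y x ≡ true) where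

  open import Data.List.Membership.DecPropositional (_≟_ {n}) using (_∈?_)

  Chain-∷⁻ : ∀ {x xs} → Chain R (x ∷ xs) → Chain R xs
  Chain-∷⁻ {xs = []}    _         = tt
  Chain-∷⁻ {xs = _ ∷ _} (_ , ch) = ch

  Chain-++⁻ʳ : ∀ xs {ys} → Chain R (xs ++ ys) → Chain R ys
  Chain-++⁻ʳ []       ch = ch
  Chain-++⁻ʳ (x ∷ xs) ch = Chain-++⁻ʳ xs (Chain-∷⁻ {x} ch)

  Chain-++⁻ˡ : ∀ xs {y ys} → Chain R (xs ++ y ∷ ys) → Chain R (xs ++ y ∷ [])
  Chain-++⁻ˡ []           _         = tt
  Chain-++⁻ˡ (x ∷ [])     (r , _)  = r , tt
  Chain-++⁻ˡ (x ∷ z ∷ xs) (r , ch) = r , Chain-++⁻ˡ (z ∷ xs) ch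

  -- A simple path from u, stored without its (known) first vertex.
  record SimplePath (u v : Fin n) : Set where
    constructor simplePath
    field
      rest     : List (Fin n)
      linked   : Chain R (u ∷ rest)
      distinct : Unique (u ∷ rest)
      ends     : lastOf u rest ≡ v
  open SimplePath

  fromPath : ∀ {u v} → Path R u v → SimplePath u v
  fromPath record { verts = x ∷ xs ; first = refl ; final = final ; chain = ch ; simple = s } =
    simplePath xs ch s (just-injective (trans (≡-sym (last≡lastOf x xs)) final))

  edgePath : ∀ {u v} → R u v ≡ true → u ≢ v → SimplePath u v
  edgePath r u≢v = simplePath (_ ∷ []) (r , tt) ((u≢v ∷ []) ∷ [] ∷ []) refl

  extend : ∀ {u x v} → R u x ≡ true → (p : SimplePath x v) → u ∉ x ∷ rest p → SimplePath u v
  extend r (simplePath xs ch s e) u∉ = simplePath (_ ∷ xs) (r , ch) (¬Any⇒All¬ _ u∉ ∷ s) e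

  -- If u already lies on the path, the path is cut short at u instead.
  prepend : ∀ {u x v} → R u x ≡ true → SimplePath x v → SimplePath u v
  prepend {u} {x} r p with u ∈? x ∷ rest p
  ... | no u∉ = extend r p u∉
  ... | yes u∈ with ∈-∃++ u∈
  ...   | ys , zs , eq = simplePath zs
          (Chain-++⁻ʳ ys (subst (Chain R) eq (linked p)))
          (unique-++⁻ʳ ys (subst Unique eq (distinct p)))
          (trans (≡-sym (lastOf-++ u ys)) (trans (cong (lastOf u) (≡-sym eq)) (ends p)))

  join : ∀ {u x v} → SimplePath u x → SimplePath x v → SimplePath u v
  join {v = v} (simplePath [] _ _ e) q = subst (λ z → SimplePath z v) (≡-sym e) q
  join (simplePath (y ∷ ys) (r , ch) (_ ∷ s) e) q = prepend r (join (simplePath ys ch s e) q)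

  reverse : ∀ {u v} → SimplePath u v → SimplePath v u
  reverse (simplePath [] _ _ e) = simplePath [] tt ([] ∷ []) (≡-sym e)
  reverse (simplePath (y ∷ ys) (r , ch) ((u≢y ∷ _) ∷ s) e) =
    join (reverse (simplePath ys ch s e)) (edgePath (R-sym _ _ r) (u≢y ∘ ≡-sym))

  -- Walk back along the b-path (extended by the edge w₀b₀) until it first meets the
  -- w-path; it cannot do so at w₀ or w₁, so the two segments close a cycle of length ≥ 3.
  cycle-from-branching :
    ∀ w₀ w₁ ws {z} → Chain R (w₀ ∷ w₁ ∷ ws) → Unique (w₀ ∷ w₁ ∷ ws) → lastOf w₁ ws ≡ z →
    ∀ b₀ bs → Chain R (b₀ ∷ bs) → Unique (b₀ ∷ bs) → lastOf b₀ bs ≡ z →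
    R w₀ b₀ ≡ true → b₀ ≢ w₁ → w₀ ∉ b₀ ∷ bs → HasCycle R
  cycle-from-branching w₀ w₁ ws chW uW endW b₀ bs chB uB endB r b₀≢w₁ w₀∉ with b₀ ∈? w₀ ∷ w₁ ∷ ws
  ... | yes (here b₀≡w₀)       = ⊥-elim (w₀∉ (here (≡-sym b₀≡w₀)))
  ... | yes (there (here b₀≡w₁)) = ⊥-elim (b₀≢w₁ b₀≡w₁)
  ... | yes (there (there b₀∈)) with ∈-∃++ b₀∈
  ...   | ys , zs , refl =
    w₀ ∷ w₁ ∷ ys ++ b₀ ∷ [] , w₀ , b₀ ,
    s≤s (s≤s (length-++-∷ ys)) , refl ,
    trans (last≡lastOf w₀ (w₁ ∷ ys ++ b₀ ∷ [])) (cong just (lastOf-++ w₁ ys)) ,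
    Chain-++⁻ˡ (w₀ ∷ w₁ ∷ ys) chW ,
    unique-++⁻ˡ (w₀ ∷ w₁ ∷ ys ++ b₀ ∷ []) (subst Unique (≡-sym (++-assoc (w₀ ∷ w₁ ∷ ys) _ zs)) uW) ,
    R-sym _ _ r
    where
      length-++-∷ : ∀ xs {x xs′} → 1 ≤ length (xs ++ x ∷ xs′)
      length-++-∷ []      = s≤s z≤n
      length-++-∷ (_ ∷ _) = s≤s z≤n
  cycle-from-branching w₀ w₁ ws chW uW endW b₀ [] chB uB endB r b₀≢w₁ w₀∉ | no b₀∉ =
    ⊥-elim (b₀∉ (subst (_∈ w₀ ∷ w₁ ∷ ws) (trans endW (≡-sym endB)) (there (lastOf-∈ w₁ ws))))
  cycle-from-branching w₀ w₁ ws chW uW endW b₀ (b₁ ∷ bs) (r′ , chB) (b₀∉bs ∷ uB) endB r b₀≢w₁ w₀∉ | no b₀∉ =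
    cycle-from-branching b₀ w₀ (w₁ ∷ ws) (R-sym _ _ r , chW) (¬Any⇒All¬ _ b₀∉ ∷ uW) endW
      b₁ bs chB uB endB r′ (w₀∉ ∘ there ∘ here ∘ ≡-sym) (All¬⇒¬Any b₀∉bs)

  module _ (acyclic : Acyclic R) where

    private
      rests-equal : ∀ {u v} xs ys →
        Chain R (u ∷ xs) → Unique (u ∷ xs) → lastOf u xs ≡ v →
        Chain R (u ∷ ys) → Unique (u ∷ ys) → lastOf u ys ≡ v → xs ≡ ys
      rests-equal []       []       _ _ _ _ _ _ = refl
      rests-equal []       (y ∷ ys) _ _ u≡v _ (u∉ ∷ _) end =
        ⊥-elim (All¬⇒¬Any u∉ (subst (_∈ y ∷ ys) (trans end (≡-sym u≡v)) (lastOf-∈ y ys)))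
      rests-equal (x ∷ xs) []       _ (u∉ ∷ _) end _ _ u≡v =
        ⊥-elim (All¬⇒¬Any u∉ (subst (_∈ x ∷ xs) (trans end (≡-sym u≡v)) (lastOf-∈ x xs)))
      rests-equal {u} (x ∷ xs) (y ∷ ys) (r , ch) (u∉xs ∷ s) e (r′ , ch′) (u∉ ∷ s′) e′ with x ≟ y
      ... | yes refl = cong (x ∷_) (rests-equal xs ys ch s e ch′ s′ e′)
      ... | no x≢y   = ⊥-elim (acyclic
        (cycle-from-branching u x xs (r , ch) (u∉xs ∷ s) e y ys ch′ s′ e′ r′ (x≢y ∘ ≡-sym) (All¬⇒¬Any u∉)))

    paths-unique : ∀ {u v} (p q : SimplePath u v) → rest p ≡ rest q
    paths-unique (simplePath xs ch s e) (simplePath ys ch′ s′ e′) = rests-equal xs ys ch s e ch′ s′ e′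

-- Spanning trees and bonds

module RemoveEdge {n : ℕ} (t : Rel n) (a b : Fin n) where

  IsEdge : Fin n → Fin n → Set
  IsEdge x y = (x ≡ a × y ≡ b) ⊎ (x ≡ b × y ≡ a)

  isEdge? : ∀ x y → Dec (IsEdge x y)
  isEdge? x y = ((x ≟ a) ×-dec (y ≟ b)) ⊎-dec ((x ≟ b) ×-dec (y ≟ a))

  -- Defs spells removeEdge with ⌊_⌋ (= isYes), which dec-true/dec-false do not see through.
  removeEdge-decides : ∀ x y → removeEdge t a b x y ≡ t x y ∧ not (does (isEdge? x y))
  removeEdge-decides x y = cong₂ (λ p q → t x y ∧ not (p ∨ q))
    (cong₂ _∧_ (isYes≗does (x ≟ a)) (isYes≗does (y ≟ b)))
    (cong₂ _∧_ (isYes≗does (x ≟ b)) (isYes≗does (y ≟ a)))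

  removeEdge-⊆ : ∀ {x y} → removeEdge t a b x y ≡ true → t x y ≡ true
  removeEdge-⊆ {x} {y} h with t x y
  ... | true = refl

  removeEdge-keeps : ∀ {x y} → t x y ≡ true → ¬ IsEdge x y → removeEdge t a b x y ≡ true
  removeEdge-keeps {x} {y} txy x≢y = trans (removeEdge-decides x y)
    (cong₂ (λ p q → p ∧ not q) txy (dec-false (isEdge? x y) x≢y))

  removeEdge-removes : ∀ {x y} → IsEdge x y → removeEdge t a b x y ≡ false
  removeEdge-removes {x} {y} e = begin
    removeEdge t a b x y             ≡⟨ removeEdge-decides x y ⟩
    t x y ∧ not (does (isEdge? x y)) ≡⟨ cong (λ d → t x y ∧ not d) (dec-true (isEdge? x y) e) ⟩
    t x y ∧ false                    ≡⟨ ∧-zeroʳ (t x y) ⟩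
    false                            ∎
    where open ≡-Reasoning

  kept⇒¬IsEdge : ∀ {x y} → removeEdge t a b x y ≡ true → ¬ IsEdge x y
  kept⇒¬IsEdge h e with () ← trans (≡-sym h) (removeEdge-removes e)

  removeEdge-sym : (∀ x y → t x y ≡ true → t y x ≡ true) →
                   ∀ x y → removeEdge t a b x y ≡ true → removeEdge t a b y x ≡ true
  removeEdge-sym t-sym x y h = removeEdge-keeps (t-sym x y (removeEdge-⊆ h)) (kept⇒¬IsEdge h ∘ swap)
    where
      swap : IsEdge y x → IsEdge x y
      swap (inj₁ (y≡a , x≡b)) = inj₂ (x≡b , y≡a)
      swap (inj₂ (y≡b , x≡a)) = inj₁ (x≡a , y≡b)

  hasStep? : ∀ xs → Dec (HasStep xs a b)
  hasStep? []           = no λ ()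
  hasStep? (_ ∷ [])     = no λ ()
  hasStep? (x ∷ y ∷ xs) = isEdge? x y ⊎-dec hasStep? (y ∷ xs)

  Chain-removeEdge⁻ : ∀ xs → Chain (removeEdge t a b) xs → Chain t xs
  Chain-removeEdge⁻ []           _        = tt
  Chain-removeEdge⁻ (_ ∷ [])     _        = tt
  Chain-removeEdge⁻ (x ∷ y ∷ xs) (r , ch) = removeEdge-⊆ r , Chain-removeEdge⁻ (y ∷ xs) ch

  Chain-removeEdge⁺ : ∀ xs → Chain t xs → ¬ HasStep xs a b → Chain (removeEdge t a b) xs
  Chain-removeEdge⁺ []           _        _     = tt
  Chain-removeEdge⁺ (_ ∷ [])     _        _     = tt
  Chain-removeEdge⁺ (x ∷ y ∷ xs) (r , ch) ¬step =
    removeEdge-keeps r (¬step ∘ inj₁) , Chain-removeEdge⁺ (y ∷ xs) ch (¬step ∘ inj₂)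

module SpanningTreeProperties {n : ℕ} {G : SimpleGraph n} {t : Rel n} (spanning : SpanningTree G t) where

  open SpanningTree spanning
  open import Data.List.Membership.DecPropositional (_≟_ {n}) using (_∈?_)

  t-sym : ∀ x y → t x y ≡ true → t y x ≡ true
  t-sym x y txy = trans (tsym y x) txy

  module T = Paths t t-sym

  treePathOf : ∀ u v → Path t u v
  treePathOf = proj₂ (proj₁ tree)

  treePath : ∀ u v → T.SimplePath u v
  treePath u v = T.fromPath (treePathOf u v)

  treePaths-unique : ∀ {u v} (p q : T.SimplePath u v) → T.SimplePath.rest p ≡ T.SimplePath.rest q
  treePaths-unique = T.paths-unique (proj₂ tree)

  module T−e (a b : Fin n) where
    open RemoveEdge t a b public
    open Paths (removeEdge t a b) (removeEdge-sym t-sym) public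

    toTreePath : ∀ {u v} → SimplePath u v → T.SimplePath u v
    toTreePath (simplePath xs ch s e) = T.simplePath xs (Chain-removeEdge⁻ _ ch) s e

    fromTreePath : ∀ {u v} (p : Path t u v) → ¬ HasStep (verts p) a b → SimplePath u v
    fromTreePath p ¬step = fromPath (record
      { verts = verts p ; first = first p ; final = final p
      ; chain = Chain-removeEdge⁺ (verts p) (chain p) ¬step ; simple = simple p })

  removeEdge-separates : ∀ {a b} → t a b ≡ true → a ≢ b → ¬ T−e.SimplePath a b a b
  removeEdge-separates {a} {b} tab a≢b p with treePaths-unique (T−e.toTreePath a b p) (T.edgePath tab a≢b)
  removeEdge-separates {a} {b} tab a≢b (T−e.simplePath (_ ∷ []) (r , _) _ _) | refl =
    T−e.kept⇒¬IsEdge a b r (inj₁ (refl , refl))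

  bond-ends-separated : ∀ {a b x y} → t a b ≡ true → a ≢ b →
    (Path (removeEdge t a b) a x × Path (removeEdge t a b) b y) ⊎
    (Path (removeEdge t a b) b x × Path (removeEdge t a b) a y) →
    ¬ T−e.SimplePath a b x y
  bond-ends-separated {a} {b} tab a≢b (inj₁ (ax , by)) xy =
    removeEdge-separates tab a≢b (join (fromPath ax) (join xy (reverse (fromPath by))))
    where open T−e a b
  bond-ends-separated {a} {b} tab a≢b (inj₂ (bx , ay)) xy =
    removeEdge-separates tab a≢b (join (fromPath ay) (reverse (join (fromPath bx) xy)))
    where open T−e a b

  -- Each tree edge joins a vertex to its parent, and each non-root vertex has exactly one parent.
  module Rooted (root : Fin n) where

    private
      next : Fin n → List (Fin n) → Fin n
      next a []      = a
      next _ (y ∷ _) = y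

    parent : Fin n → Fin n
    parent a = next a (T.SimplePath.rest (treePath a root))

    parent-edge : ∀ {a} → a ≢ root → t a (parent a) ≡ true × a ≢ parent a
    parent-edge {a} a≢r with treePath a root
    ... | T.simplePath []      _       _        a≡r = ⊥-elim (a≢r a≡r)
    ... | T.simplePath (_ ∷ _) (r , _) (a∉ ∷ _) _   = r , All.head a∉

    parent-root : parent root ≡ root
    parent-root = cong (next root) (treePaths-unique (treePath root root) (T.simplePath [] tt ([] ∷ []) refl))

    parent⇒edge : ∀ {a b} → parent a ≡ b → a ≢ b → t a b ≡ true
    parent⇒edge {a} refl a≢pa with a ≟ root
    ... | yes refl = ⊥-elim (a≢pa (≡-sym parent-root))
    ... | no  a≢r  = proj₁ (parent-edge a≢r)

    edge⇒parent : ∀ {a b} → t a b ≡ true → a ≢ b → parent a ≡ b ⊎ parent b ≡ a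
    edge⇒parent {a} {b} tab a≢b with treePath a root
    ... | T.simplePath xs ch s e with b ∈? xs
    ...   | no b∉ = inj₂ (cong (next b) (treePaths-unique (treePath b root)
                      (T.extend (t-sym a b tab) (T.simplePath xs ch s e) b∉a∷xs)))
      where
        b∉a∷xs : b ∉ a ∷ xs
        b∉a∷xs (here b≡a)  = a≢b (≡-sym b≡a)
        b∉a∷xs (there b∈) = b∉ b∈
    ...   | yes b∈ with ∈-∃++ b∈
    ...     | ys , zs , refl = inj₁ (cong (next a) (treePaths-unique (T.simplePath (ys ++ b ∷ zs) ch s e) viaEdge))
      where
        a∉ : a ∉ ys ++ b ∷ zs
        a∉ = Uniqueₚ.Unique[x∷xs]⇒x∉xs s
        viaEdge : T.SimplePath a root
        viaEdge = T.extend tab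
          (T.simplePath zs (T.Chain-++⁻ʳ (a ∷ ys) ch) (unique-++⁻ʳ (a ∷ ys) s) (trans (≡-sym (lastOf-++ a ys)) e))
          (a∉ ∘ ∈-++⁺ʳ ys)

    parent-not-involutive : ∀ {a b} → a ≢ b → parent a ≡ b → parent b ≡ a → ⊥
    parent-not-involutive {a} {b} a≢b with treePath a root | treePath b root
    ... | T.simplePath [] _ _ _       | _                         = λ a≡b _ → a≢b a≡b
    ... | T.simplePath (_ ∷ _) _ _ _  | T.simplePath [] _ _ _     = λ _ b≡a → a≢b (≡-sym b≡a)
    ... | T.simplePath (_ ∷ xs) (_ , ch) (a∉ ∷ s) e | T.simplePath (_ ∷ ys) ch′ s′ e′ = λ { refl refl →
          All¬⇒¬Any a∉ (there (subst (a ∈_)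
            (≡-sym (treePaths-unique (T.simplePath xs ch s e) (T.simplePath (a ∷ ys) ch′ s′ e′))) (here refl))) }

    𝟙parent : Fin n → Fin n → ℕ
    𝟙parent a b = 𝟙 ⌊ parent a ≟ b ⌋

    edge-indicator : ∀ {a b} → a ≢ b → 𝟙 (t a b) ≡ 𝟙parent a b + 𝟙parent b a
    edge-indicator {a} {b} a≢b with t a b in tab | parent a ≟ b | parent b ≟ a
    ... | true  | yes pa≡b | yes pb≡a = ⊥-elim (parent-not-involutive a≢b pa≡b pb≡a)
    ... | true  | yes _    | no  _    = refl
    ... | true  | no  _    | yes _    = refl
    ... | true  | no  pa≢b | no  pb≢a = ⊥-elim ([ pa≢b , pb≢a ]′ (edge⇒parent tab a≢b))
    ... | false | yes pa≡b | _        with () ← trans (≡-sym tab) (parent⇒edge pa≡b a≢b)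
    ... | false | no  _    | yes pb≡a with () ← trans (≡-sym tab) (trans (tsym a b) (parent⇒edge pb≡a (a≢b ∘ ≡-sym)))
    ... | false | no  _    | no  _    = refl

    nonRoot : Fin n → ℕ
    nonRoot u = if ⌊ u ≟ root ⌋ then 0 else 1

    private
      Fs = allFin n

      parent-count : ∀ u → ∑ Fs (λ v → if ⌊ u ≟ v ⌋ then 0 else 𝟙parent u v) ≡ nonRoot u
      parent-count u = trans (∑-single Fs (Uniqueₚ.allFin⁺ n) (∈-allFin (parent u)) off) at-parent
        where
          off : ∀ v → v ∈ Fs → v ≢ parent u → (if ⌊ u ≟ v ⌋ then 0 else 𝟙parent u v) ≡ 0
          off v _ v≢pu with u ≟ v | parent u ≟ v
          ... | yes _ | _        = refl
          ... | no  _ | no  _    = refl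
          ... | no  _ | yes pu≡v = ⊥-elim (v≢pu (≡-sym pu≡v))
          at-parent : (if ⌊ u ≟ parent u ⌋ then 0 else 𝟙parent u (parent u)) ≡ nonRoot u
          at-parent with u ≟ root | u ≟ parent u | parent u ≟ parent u
          ... | _        | _        | no  ≢refl = ⊥-elim (≢refl refl)
          ... | yes _    | yes _    | yes _     = refl
          ... | yes refl | no  r≢pr | yes _     = ⊥-elim (r≢pr (≡-sym parent-root))
          ... | no  u≢r  | yes u≡pu | yes _     = ⊥-elim (proj₂ (parent-edge u≢r) u≡pu)
          ... | no  _    | no  _    | yes _     = refl

    edgeCount≡nonRoots : countPairs t ≡ ∑ (allFin n) nonRoot
    edgeCount≡nonRoots = begin
      sumPairs (λ u v → 𝟙 (t u v))
        ≡⟨ sumPairs-cong (λ u v u<v → edge-indicator (Finₚ.<⇒≢ u<v)) ⟩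
      sumPairs (λ u v → 𝟙parent u v + 𝟙parent v u)
        ≡⟨ sumPairs-symmetrise 𝟙parent ⟩
      ∑ Fs (λ u → ∑ Fs (λ v → if ⌊ u ≟ v ⌋ then 0 else 𝟙parent u v))
        ≡⟨ ∑-cong Fs (λ u _ → parent-count u) ⟩
      ∑ Fs nonRoot ∎
      where open ≡-Reasoning

  tree-size : countPairs t + 1 ≡ n
  tree-size = trans (cong (_+ 1) edgeCount≡nonRoots) (∑-allFin-except root)
    where
      root = Fin.fromℕ< (proj₁ (proj₁ tree))
      open Rooted root

module BondProperties {n : ℕ} {G : SimpleGraph n} {t : Rel n} (spanning : SpanningTree G t)
                      {bhat : BondFamily n} (nonRedundant : NonRedundantBondSet G t bhat) where

  open SpanningTree spanning
  open NonRedundantBondSet nonRedundant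
  open SpanningTreeProperties spanning

  tree-edge-in-own-bond : ∀ {a b} → TreeEdge t a b → bhat a b a b ≡ true
  tree-edge-in-own-bond {a} {b} (a<b , tab) with cover a b (a<b , sub a b tab)
  ... | a′ , b′ , e′ , inBond with (a′ ≟ a) ×-dec (b′ ≟ b)
  ...   | yes (refl , refl) = inBond
  ...   | no  e′≢e          = ⊥-elim (bond-ends-separated (proj₂ e′) (Finₚ.<⇒≢ (proj₁ e′))
                                (proj₂ (subset a′ b′ a b e′ a<b inBond)) (edgePath kept (Finₚ.<⇒≢ a<b)))
    where
      open T−e a′ b′
      kept : removeEdge t a′ b′ a b ≡ true
      kept = removeEdge-keeps tab λ
        { (inj₁ (a≡a′ , b≡b′)) → e′≢e (≡-sym a≡a′ , ≡-sym b≡b′)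
        ; (inj₂ (refl , refl)) → Finₚ.<-asym a<b (proj₁ e′) }

  -- The tree path between the ends of a bond edge of e cannot avoid e, as T − e separates them.
  bond-edge-cycle-through : ∀ {a b x y} → TreeEdge t a b → x <ᶠ y → bhat a b x y ≡ true →
                            Σ (Path t x y) λ p → HasStep (verts p) a b
  bond-edge-cycle-through {a} {b} {x} {y} (a<b , tab) x<y inBond with T−e.hasStep? a b (verts (treePathOf x y))
  ... | yes step = treePathOf x y , step
  ... | no ¬step = ⊥-elim (bond-ends-separated tab (Finₚ.<⇒≢ a<b)
                     (proj₂ (subset a b x y (a<b , tab) x<y inBond)) (T−e.fromTreePath a b (treePathOf x y) ¬step))

  bonds-disjoint : ∀ {a b a′ b′ x y} → TreeEdge t a b → TreeEdge t a′ b′ → x <ᶠ y →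
                   bhat a b x y ≡ true → bhat a′ b′ x y ≡ true → (a , b) ≡ (a′ , b′)
  bonds-disjoint {a} {b} {a′} {b′} {x} {y} e e′ x<y inBond inBond′
    with unique x y a b a′ b′ (proj₁ (subset a b x y e x<y inBond)) e e′ inBond inBond′
  ... | refl , refl = refl

-- Double counting

module Counting {n : ℕ} {G : SimpleGraph n} {t : Rel n} (spanning : SpanningTree G t)
                {bhat : BondFamily n} (nonRedundant : NonRedundantBondSet G t bhat) where

  open NonRedundantBondSet nonRedundant
  open SpanningTreeProperties spanning using (tree-size)
  open BondProperties spanning nonRedundant

  edges : List (Fin n × Fin n)
  edges = allEdges

  isTree : Fin n × Fin n → Bool
  isTree (a , b) = t a b

  inBond : Fin n × Fin n → Fin n × Fin n → Bool
  inBond (a , b) (x , y) = bhat a b x y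

  size : Fin n × Fin n → ℕ
  size (a , b) = bondSize bhat a b

  size≡∑ : ∀ e → size e ≡ ∑ edges (𝟙 ∘ inBond e)
  size≡∑ (a , b) = sumPairs≡∑allEdges (λ x y → 𝟙 (bhat a b x y))

  treeEdge : ∀ {e} → e ∈ edges → isTree e ≡ true → TreeEdge t (proj₁ e) (proj₂ e)
  treeEdge e∈ te = ∈-allEdges⁻ e∈ , te

  bonds-partition : ∀ f → f ∈ edges →
    ∑ edges (λ e → if isTree e then 𝟙 (inBond e f) else 0) ≡ 𝟙 (adj G (proj₁ f) (proj₂ f))
  bonds-partition (x , y) f∈ with adj G x y in xy
  ... | false = ∑-zero edges none
    where
      none : ∀ e → e ∈ edges → (if isTree e then 𝟙 (inBond e (x , y)) else 0) ≡ 0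
      none e e∈ with isTree e in te | inBond e (x , y) in ie
      ... | false | _     = refl
      ... | true  | false = refl
      ... | true  | true  with () ← trans (≡-sym xy) (proj₂ (proj₁ (subset _ _ x y (treeEdge e∈ te) (∈-allEdges⁻ f∈) ie)))
  ... | true with cover x y (∈-allEdges⁻ f∈ , xy)
  ...   | a , b , e₀ , inBond₀ = trans (∑-single edges allEdges-unique (∈-allEdges⁺ (proj₁ e₀)) others) at-e₀
    where
      at-e₀ : (if t a b then 𝟙 (bhat a b x y) else 0) ≡ 1
      at-e₀ rewrite proj₂ e₀ | inBond₀ = refl
      others : ∀ e → e ∈ edges → e ≢ (a , b) → (if isTree e then 𝟙 (inBond e (x , y)) else 0) ≡ 0
      others e e∈ e≢e₀ with isTree e in te | inBond e (x , y) in ie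
      ... | false | _     = refl
      ... | true  | false = refl
      ... | true  | true  = ⊥-elim (e≢e₀ (bonds-disjoint (treeEdge e∈ te) e₀ (∈-allEdges⁻ f∈) ie inBond₀))

  ∑-size : ∑ edges (λ e → if isTree e then size e else 0) ≡ countPairs (adj G)
  ∑-size = begin
    ∑ edges (λ e → if isTree e then size e else 0)
      ≡⟨ ∑-cong edges (λ e _ → trans (cong (λ s → if isTree e then s else 0) (size≡∑ e)) (∑-if edges (isTree e) _)) ⟩
    ∑ edges (λ e → ∑ edges (λ f → if isTree e then 𝟙 (inBond e f) else 0))
      ≡⟨ ∑-swap edges edges (λ e f → if isTree e then 𝟙 (inBond e f) else 0) ⟩
    ∑ edges (λ f → ∑ edges (λ e → if isTree e then 𝟙 (inBond e f) else 0))
      ≡⟨ ∑-cong edges bonds-partition ⟩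
    ∑ edges (λ f → 𝟙 (adj G (proj₁ f) (proj₂ f)))
      ≡⟨ ≡-sym (sumPairs≡∑allEdges (λ x y → 𝟙 (adj G x y))) ⟩
    countPairs (adj G) ∎
    where open ≡-Reasoning

  size-pos : ∀ {e} → e ∈ edges → isTree e ≡ true → 1 ≤ size e
  size-pos {e} e∈ te = subst₂ _≤_ (cong 𝟙 (tree-edge-in-own-bond (treeEdge e∈ te))) (≡-sym (size≡∑ e))
                         (term≤∑ edges {𝟙 ∘ inBond e} e∈)

  cyclomatic≡∑φ : cyclomatic G ≡ sumTree t (phi bhat)
  cyclomatic≡∑φ = begin
    countPairs (adj G) + 1 ∸ n       ≡⟨ cong (λ m → m + 1 ∸ n) (≡-sym (trans ∑φ+treeSize ∑-size)) ⟩
    ∑φ + countPairs t + 1 ∸ n        ≡⟨ cong (_∸ n) (+-assoc ∑φ (countPairs t) 1) ⟩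
    ∑φ + (countPairs t + 1) ∸ n      ≡⟨ cong (λ m → ∑φ + m ∸ n) tree-size ⟩
    ∑φ + n ∸ n                       ≡⟨ m+n∸n≡m ∑φ n ⟩
    ∑φ                               ≡⟨ ≡-sym (sumPairs≡∑allEdges (λ a b → if t a b then phi bhat a b else 0)) ⟩
    sumTree t (phi bhat)             ∎
    where
      open ≡-Reasoning
      ∑φ = ∑ edges (λ e → if isTree e then size e ∸ 1 else 0)
      ∑φ+treeSize : ∑φ + countPairs t ≡ ∑ edges (λ e → if isTree e then size e else 0)
      ∑φ+treeSize = begin
        ∑φ + countPairs t                 ≡⟨ cong (∑φ +_) (sumPairs≡∑allEdges (λ a b → 𝟙 (t a b))) ⟩
        ∑φ + ∑ edges (𝟙 ∘ isTree)      ≡⟨ ≡-sym (∑-+ edges _ _) ⟩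
        ∑ edges (λ e → (if isTree e then size e ∸ 1 else 0) + 𝟙 (isTree e)) ≡⟨ ∑-cong edges restore ⟩
        ∑ edges (λ e → if isTree e then size e else 0) ∎
        where
          restore : ∀ e → e ∈ edges → (if isTree e then size e ∸ 1 else 0) + 𝟙 (isTree e) ≡ (if isTree e then size e else 0)
          restore e e∈ with isTree e in te
          ... | true  = m∸n+n≡m (size-pos e∈ te)
          ... | false = refl

  bondCycleEdge : Fin n × Fin n → Fin n × Fin n → Bool
  bondCycleEdge e f = inBond e f ∧ not (isTree f)

  bondCycleEdge⁻ : ∀ e f → bondCycleEdge e f ≡ true → inBond e f ≡ true × isTree f ≡ false
  bondCycleEdge⁻ e f h with inBond e f | isTree f
  ... | true | false = refl , refl

  cycleEdgeCount : Fin n × Fin n → ℕ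
  cycleEdgeCount e = ∑ edges (𝟙 ∘ bondCycleEdge e)

  -- e is the only tree edge in its own bond.
  size≤cycleEdgeCount+1 : ∀ {e} → e ∈ edges → isTree e ≡ true → size e ≤ cycleEdgeCount e + 1
  size≤cycleEdgeCount+1 {e} e∈ te = begin
    size e                                              ≡⟨ size≡∑ e ⟩
    ∑ edges (𝟙 ∘ inBond e)                              ≤⟨ ∑-mono edges split ⟩
    ∑ edges (λ f → 𝟙 (bondCycleEdge e f) + 𝟙 ⌊ f ≟ₑ e ⌋)      ≡⟨ ∑-+ edges _ _ ⟩
    cycleEdgeCount e + ∑ edges (λ f → 𝟙 ⌊ f ≟ₑ e ⌋)     ≡⟨ cong (cycleEdgeCount e +_) (∑-𝟙-≡ _≟ₑ_ edges allEdges-unique e∈) ⟩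
    cycleEdgeCount e + 1                                ∎
    where
      open ≤-Reasoning
      _≟ₑ_ : DecidableEquality (Fin n × Fin n)
      _≟ₑ_ = ≡-dec _≟_ _≟_
      split : ∀ f → f ∈ edges → 𝟙 (inBond e f) ≤ 𝟙 (bondCycleEdge e f) + 𝟙 ⌊ f ≟ₑ e ⌋
      split f f∈ with inBond e f in ief | isTree f in tf
      ... | false | _     = z≤n
      ... | true  | false = s≤s z≤n
      ... | true  | true  with f ≟ₑ e
      ...   | yes _   = s≤s z≤n
      ...   | no  f≢e = ⊥-elim (f≢e (bonds-disjoint (treeEdge f∈ tf) (treeEdge e∈ te) (∈-allEdges⁻ f∈)
                                       (tree-edge-in-own-bond (treeEdge f∈ tf)) ief))

  φ≤cycleEdgeCount : ∀ {e} → e ∈ edges → isTree e ≡ true → size e ∸ 1 ≤ cycleEdgeCount e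
  φ≤cycleEdgeCount {e} e∈ te =
    ≤-trans (∸-monoˡ-≤ 1 (size≤cycleEdgeCount+1 e∈ te)) (≤-reflexive (m+n∸n≡m (cycleEdgeCount e) 1))

  sharedBonds : (Fin n × Fin n) × (Fin n × Fin n) → ℕ
  sharedBonds (f , f′) = ∑ edges (λ e → if isTree e then 𝟙 (bondCycleEdge e f) * 𝟙 (bondCycleEdge e f′) else 0)

  private
    shared-pos : ∀ c x y → 0 < (if c then 𝟙 x * 𝟙 y else 0) → c ≡ true × x ≡ true × y ≡ true
    shared-pos true true true _ = refl , refl , refl

    shared≤1 : ∀ c x y → (if c then 𝟙 x * 𝟙 y else 0) ≤ 1
    shared≤1 false _     _ = z≤n
    shared≤1 true  false _ = z≤n
    shared≤1 true  true  y = subst (_≤ 1) (≡-sym (*-identityˡ (𝟙 y))) (𝟙≤1 y)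

  sharedBonds≤1 : ∀ {p} → p ∈ pairs edges → sharedBonds p ≤ 1
  sharedBonds≤1 {f , f′} p∈ = ∑-≤1 edges _ allEdges-unique (λ e _ → shared≤1 (isTree e) (bondCycleEdge e f) (bondCycleEdge e f′)) same
    where
      same : ∀ e e′ → e ∈ edges → e′ ∈ edges →
             0 < (if isTree e then 𝟙 (bondCycleEdge e f) * 𝟙 (bondCycleEdge e f′) else 0) →
             0 < (if isTree e′ then 𝟙 (bondCycleEdge e′ f) * 𝟙 (bondCycleEdge e′ f′) else 0) → e ≡ e′
      same e e′ e∈ e′∈ pos pos′ with shared-pos (isTree e) (bondCycleEdge e f) (bondCycleEdge e f′) pos
                                  | shared-pos (isTree e′) (bondCycleEdge e′ f) (bondCycleEdge e′ f′) pos′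
      ... | te , off , _ | te′ , off′ , _ =
        bonds-disjoint (treeEdge e∈ te) (treeEdge e′∈ te′) (∈-allEdges⁻ (proj₁ (∈-pairs⁻ edges p∈)))
          (proj₁ (bondCycleEdge⁻ e f off)) (proj₁ (bondCycleEdge⁻ e′ f off′))

  sharedBond⇒intersecting : ∀ {p} → p ∈ pairs edges → 0 < sharedBonds p → IntersectingPair G t p
  sharedBond⇒intersecting {(v , w) , (v′ , w′)} p∈ pos
    with ∑-pos edges _ pos
  ... | (a , b) , e∈ , pos-e with shared-pos (t a b) (bondCycleEdge (a , b) (v , w)) (bondCycleEdge (a , b) (v′ , w′)) pos-e
  ...   | te , off , off′ with bondCycleEdge⁻ (a , b) (v , w) off | bondCycleEdge⁻ (a , b) (v′ , w′) off′
  ...     | inB , notT | inB′ , notT′ =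
    (proj₁ (subset a b v w e v<w inB) , notT) ,
    (proj₁ (subset a b v′ w′ e v′<w′ inB′) , notT′) ,
    pairs-related edges allEdges-sorted p∈ ,
    a , b , inj₂ (bond-edge-cycle-through e v<w inB) , inj₂ (bond-edge-cycle-through e v′<w′ inB′)
    where
      e = treeEdge e∈ te
      v<w = ∈-allEdges⁻ (proj₁ (∈-pairs⁻ edges p∈))
      v′<w′ = ∈-allEdges⁻ (proj₂ (∈-pairs⁻ edges p∈))

  ∑φC2≤intersections : ∀ {k} → CapT G t k → sumTree t (λ a b → phi bhat a b C 2) ≤ k
  ∑φC2≤intersections {k} (intersecting , intersecting-unique , ∈⇔ , length≡k) = begin
    sumTree t (λ a b → phi bhat a b C 2)
      ≡⟨ sumPairs≡∑allEdges (λ a b → if t a b then phi bhat a b C 2 else 0) ⟩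
    ∑ edges (λ e → if isTree e then (size e ∸ 1) C 2 else 0)
      ≤⟨ ∑-mono edges bound ⟩
    ∑ edges (λ e → if isTree e then cycleEdgeCount e C 2 else 0)
      ≡⟨ ∑-cong edges (λ e _ → choose e) ⟩
    ∑ edges (λ e → ∑ (pairs edges) (λ p → if isTree e then 𝟙 (bondCycleEdge e (proj₁ p)) * 𝟙 (bondCycleEdge e (proj₂ p)) else 0))
      ≡⟨ ∑-swap edges (pairs edges) _ ⟩
    ∑ (pairs edges) sharedBonds
      ≤⟨ ∑-≤-length (pairs edges) sharedBonds intersecting (pairs-unique allEdges-unique)
           (λ p → sharedBonds≤1) (λ p p∈ pos → Equivalence.from (∈⇔ p) (sharedBond⇒intersecting p∈ pos)) ⟩
    length intersecting
      ≡⟨ length≡k ⟩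
    k ∎
    where
      open ≤-Reasoning
      bound : ∀ e → e ∈ edges → (if isTree e then (size e ∸ 1) C 2 else 0) ≤ (if isTree e then cycleEdgeCount e C 2 else 0)
      bound e e∈ with isTree e in te
      ... | true  = C2-mono (φ≤cycleEdgeCount e∈ te)
      ... | false = z≤n
      choose : ∀ e → (if isTree e then cycleEdgeCount e C 2 else 0) ≡
               ∑ (pairs edges) (λ p → if isTree e then 𝟙 (bondCycleEdge e (proj₁ p)) * 𝟙 (bondCycleEdge e (proj₂ p)) else 0)
      choose e = trans (cong (λ c → if isTree e then c else 0) (≡-sym (∑-pairs edges (𝟙 ∘ bondCycleEdge e) (𝟙≤1 ∘ bondCycleEdge e))))
                       (∑-if (pairs edges) (isTree e) _)

lemma3 : (n : ℕ) (G : SimpleGraph n) → Connected (adj G) →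
         (t : Rel n) (k : ℕ) → IsMSTCI G t k →
         (bhat : BondFamily n) → NonRedundantBondSet G t bhat →
         (sumTree t (λ a b → phi bhat a b C 2) ≤ k)
         × (cyclomatic G ≡ sumTree t (phi bhat))
lemma3 n G _ t k (spanning , intersections , _) bhat nonRedundant =
  ∑φC2≤intersections intersections , cyclomatic≡∑φ
  where open Counting spanning nonRedundant
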